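{- Let $G$ be a graph on $n$ vertices and $k\in\{1,\dots,n\}$. Then $G$ admits a greedy packing $k$-coloring if and only if there exists an independent set $A$ of cardinality $n$ in $G(k)$ such that, for every $i\in\{1,\dots,k-1\}$, the set $A^i=A\cap V(G^i)$ is a maximal independent set of the graph $G^i-\bigcup_{j=1}^{i-1}A^j$, i.e. of the subgraph of $G^i$ induced by the vertices $u^i$ such that $u^j\notin A$ for all $j<i$.
   Context: All graphs are finite and simple; $d_G(u,v)$ is the distance in $G$ (infinite if $u,v$ lie in different components). A packing $k$-coloring of $G$ is a map $c:V(G)\to\{1,\dots,k\}$ such that $c(u)=c(v)=i$ with $u\neq v$ implies $d_G(u,v)>i$. A greedy packing $k$-coloring is a packing coloring $c:V(G)\to\{1,\dots,k\}$ that can be output by the greedy procedure that processes the vertices in some order and gives each vertex the smallest color $i$ such that no already-colored vertex of color $i$ lies at distance at most $i$ from it. Equivalently, it is a packing coloring $c:V(G)\to\{1,\dots,k\}$ such that for every vertex $v$ with $c(v)=i$ and every $j\in\{1,\dots,i-1\}$ there is a vertex $u$ with $c(u)=j$ and $d_G(u,v)\le j$. For a positive integer $\ell$, $G^{\ell}$ is the graph with vertex set $\{v^{\ell}:v\in V(G)\}$ in which $u^{\ell}v^{\ell}$ is an edge iff $u\neq v$ and $d_G(u,v)\le \ell$. For a positive integer $k$, $G(k)$ is the graph with vertex set $\bigcup_{i=1}^k V(G^i)$ and edge set $\{v^jv^i: v\in V(G),\,1\le i<j\le k\}\cup\bigcup_{i=1}^k E(G^i)$. -}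

module Defs where

open import Data.Nat using (ℕ; zero; suc; _≤_; _<_)
open import Data.Fin using (Fin)
open import Data.Product using (_×_; _,_; Σ; ∃)
open import Data.Sum using (_⊎_)
open import Data.List using (List; length)
open import Data.List.Membership.Propositional using (_∈_; _∉_)
open import Data.List.Relation.Unary.Unique.Propositional using (Unique)
open import Relation.Binary.PropositionalEquality using (_≡_; _≢_)
open import Relation.Binary.Definitions using (Decidable)
open import Relation.Nullary using (¬_)

record Graph (n : ℕ) : Set₁ where
  field
    Adj    : Fin n → Fin n → Set
    Adj?   : Decidable Adj
    sym    : ∀ {u v} → Adj u v → Adj v u
    irrefl : ∀ {u} → ¬ Adj u u
open Graph public

-- Within G ℓ u v : there is a walk from u to v with at most ℓ edges,
-- i.e. d_G(u,v) ≤ ℓ (false if u, v lie in different components).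
data Within {n : ℕ} (G : Graph n) : ℕ → Fin n → Fin n → Set where
  here : ∀ {ℓ u} → Within G ℓ u u
  step : ∀ {ℓ u w v} → Adj G u w → Within G ℓ w v → Within G (suc ℓ) u v

IsPackingColoring : ∀ {n} → Graph n → ℕ → (Fin n → ℕ) → Set
IsPackingColoring G k c =
  (∀ v → 1 ≤ c v × c v ≤ k) ×
  (∀ u v → u ≢ v → c u ≡ c v → ¬ Within G (c u) u v)

-- Greedy packing k-coloring (second, equivalent description in the paper).
IsGreedyPackingColoring : ∀ {n} → Graph n → ℕ → (Fin n → ℕ) → Set
IsGreedyPackingColoring G k c =
  IsPackingColoring G k c ×
  (∀ v j → 1 ≤ j → j < c v → ∃ λ u → c u ≡ j × Within G j u v)

PowAdj : ∀ {n} → Graph n → ℕ → Fin n → Fin n → Set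
PowAdj G i u v = u ≢ v × Within G i u v

-- Adjacency in G(k): vertices are pairs (v , i) with 1 ≤ i ≤ k, standing for v^i.
GkAdj : ∀ {n} → Graph n → (Fin n × ℕ) → (Fin n × ℕ) → Set
GkAdj G (u , i) (v , j) = (u ≡ v × i ≢ j) ⊎ (i ≡ j × PowAdj G i u v)

IsVertexSetOfGk : ∀ {n} → ℕ → List (Fin n × ℕ) → Set
IsVertexSetOfGk k A = Unique A × (∀ {v i} → (v , i) ∈ A → 1 ≤ i × i ≤ k)

IndependentIn : ∀ {V : Set} → (V → V → Set) → (V → Set) → Set
IndependentIn Adj S = ∀ x y → S x → S y → ¬ Adj x y

MaximalIndependentIn : ∀ {V : Set} → (V → V → Set) → (V → Set) → (V → Set) → Set
MaximalIndependentIn Adj W S =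
  (∀ x → S x → W x) ×
  IndependentIn Adj S ×
  (∀ x → W x → ¬ S x → ∃ λ y → S y × Adj y x)

Layer : ∀ {n} → List (Fin n × ℕ) → ℕ → Fin n → Set
Layer A i u = (u , i) ∈ A

Remaining : ∀ {n} → List (Fin n × ℕ) → ℕ → Fin n → Set
Remaining A i u = ∀ j → 1 ≤ j → j < i → (u , j) ∉ A

{-# OPTIONS --safe #-}
-- A colouring c corresponds to the set A = {v^(c v)} of vertices of G(k).  The edges v^i v^j
-- of G(k) allow at most one copy of each vertex in an independent set, so |A| = n forces
-- exactly one: A is the graph of a colouring.  Independence of A^i in G^i is then the
-- packing condition for colour i, and maximality of A^i among the vertices not coloured
-- below i is the greedy condition for colour i.
module Submission where

open import Defs hiding (sym)
open import Data.Nat using (ℕ; _≤_; _<_; _≟_)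
open import Data.Nat.Properties using (<-cmp; <-irrefl; <-trans; <-≤-trans; ≤-reflexive; ≤⇒≯)
open import Data.Fin using (Fin; zero; suc; punchOut) renaming (_≟_ to _≟ᶠ_)
open import Data.Fin.Properties using (injective⇒≤; punchOut-injective; any?)
open import Data.Product using (_×_; ∃; _,_; proj₁; proj₂)
open import Data.Sum using (inj₁; inj₂)
open import Data.List using (List; _∷_; length; lookup; tabulate)
open import Data.List.Properties using (length-tabulate)
import Data.List.Relation.Unary.All as All
open import Data.List.Relation.Unary.AllPairs using (_∷_)
open import Data.List.Relation.Unary.Unique.Propositional using (Unique)
open import Data.List.Relation.Unary.Unique.Propositional.Properties using (tabulate⁺)
open import Data.List.Membership.Propositional using (_∈_)
open import Data.List.Membership.Propositional.Properties using (∈-lookup; ∈-tabulate⁺; ∈-tabulate⁻)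
open import Relation.Binary.PropositionalEquality using (_≡_; _≢_; refl; sym; trans; cong; subst)
open import Relation.Binary.Definitions using (tri<; tri≈; tri>)
open import Relation.Nullary using (yes; no; ¬_; contradiction)
open import Function using (_∘_)
open import Function.Definitions using (Injective)
open import Function.Bundles using (_⇔_; mk⇔)

≤∧injective⇒surjective : ∀ {m n} {f : Fin m → Fin n} →
  n ≤ m → Injective _≡_ _≡_ f → ∀ v → ∃ λ i → f i ≡ v
≤∧injective⇒surjective {m} {ℕ.suc _} {f} n≤m f-inj v with any? (λ i → f i ≟ᶠ v)
... | yes hit = hit
... | no miss = contradiction n≤m (≤⇒≯ (injective⇒≤ g-inj))
  where
  v∉image : ∀ i → v ≢ f i
  v∉image i v≡fi = miss (i , sym v≡fi)
  g-inj : Injective _≡_ _≡_ (λ i → punchOut (v∉image i))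
  g-inj {i} {j} = f-inj ∘ punchOut-injective (v∉image i) (v∉image j)

Unique⇒lookup-injective : ∀ {X : Set} {xs : List X} → Unique xs → Injective _≡_ _≡_ (lookup xs)
Unique⇒lookup-injective {xs = _ ∷ _}  (_  ∷ _)  {zero}  {zero}  _  = refl
Unique⇒lookup-injective {xs = _ ∷ xs} (x∉ ∷ _)  {zero}  {suc j} eq =
  contradiction eq (All.lookup x∉ (∈-lookup {xs = xs} j))
Unique⇒lookup-injective {xs = _ ∷ xs} (x∉ ∷ _)  {suc i} {zero}  eq =
  contradiction (sym eq) (All.lookup x∉ (∈-lookup {xs = xs} i))
Unique⇒lookup-injective {xs = _ ∷ _}  (_  ∷ uq) {suc i} {suc j} eq =
  cong suc (Unique⇒lookup-injective uq eq)

injectiveOn∧≤length⇒surjective : ∀ {X : Set} {n} (f : X → Fin n) {xs : List X} → Unique xs →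
  (∀ {x y} → x ∈ xs → y ∈ xs → f x ≡ f y → x ≡ y) → n ≤ length xs →
  ∀ v → ∃ λ x → x ∈ xs × f x ≡ v
injectiveOn∧≤length⇒surjective f {xs} uq f-inj n≤len v =
  let i , fxᵢ≡v = ≤∧injective⇒surjective n≤len f∘lookup-inj v
  in lookup xs i , ∈-lookup i , fxᵢ≡v
  where
  f∘lookup-inj : Injective _≡_ _≡_ (λ i → f (lookup xs i))
  f∘lookup-inj {i} {j} = Unique⇒lookup-injective uq ∘ f-inj (∈-lookup i) (∈-lookup j)

module _ {n} (G : Graph n) where

  GkIndependent : List (Fin n × ℕ) → Set
  GkIndependent A = IndependentIn (GkAdj G) (_∈ A)

  IsGreedyLayering : ℕ → List (Fin n × ℕ) → Set
  IsGreedyLayering k A =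
    IsVertexSetOfGk k A × length A ≡ n × GkIndependent A ×
    (∀ i → 1 ≤ i → i < k → MaximalIndependentIn (PowAdj G i) (Remaining A i) (Layer A i))

  GkIndependent⇒layer-unique : ∀ {A v i j} → GkIndependent A → (v , i) ∈ A → (v , j) ∈ A → i ≡ j
  GkIndependent⇒layer-unique {i = i} {j} ind p q with i ≟ j
  ... | yes i≡j = i≡j
  ... | no  i≢j = contradiction (inj₁ (refl , i≢j)) (ind _ _ p q)

  GkIndependent⇒proj₁-injectiveOn : ∀ {A x y} → GkIndependent A → x ∈ A → y ∈ A →
    proj₁ x ≡ proj₁ y → x ≡ y
  GkIndependent⇒proj₁-injectiveOn {x = u , _} ind p q refl =
    cong (u ,_) (GkIndependent⇒layer-unique ind p q)

  GkIndependent∧≤length⇒covers : ∀ {A} → Unique A → GkIndependent A → n ≤ length A →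
    ∀ v → ∃ λ i → (v , i) ∈ A
  GkIndependent∧≤length⇒covers uq ind n≤len v
    with (_ , i) , p , refl ← injectiveOn∧≤length⇒surjective proj₁ uq
                                (GkIndependent⇒proj₁-injectiveOn ind) n≤len v
    = i , p

graph : ∀ {n} → (Fin n → ℕ) → List (Fin n × ℕ)
graph c = tabulate (λ v → v , c v)

module _ {n} {c : Fin n → ℕ} where

  ∈-graph⁺ : ∀ v → (v , c v) ∈ graph c
  ∈-graph⁺ = ∈-tabulate⁺

  ∈-graph⁻ : ∀ {v i} → (v , i) ∈ graph c → i ≡ c v
  ∈-graph⁻ p with _ , refl ← ∈-tabulate⁻ p = refl

  graph-unique : Unique (graph c)
  graph-unique = tabulate⁺ (cong proj₁)

  module _ {G : Graph n} {k : ℕ} where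

    packing⇒graph-GkIndependent : IsPackingColoring G k c → GkIndependent G (graph c)
    packing⇒graph-GkIndependent _ _ _ p q (inj₁ (refl , i≢j)) =
      i≢j (trans (∈-graph⁻ p) (sym (∈-graph⁻ q)))
    packing⇒graph-GkIndependent (_ , separated) (u , i) (v , _) p q (inj₂ (refl , u≢v , i-close)) =
      separated u v u≢v (trans (sym (∈-graph⁻ p)) (∈-graph⁻ q))
        (subst (λ i → Within G i u v) (∈-graph⁻ p) i-close)

    greedy⇒graph-layer-maximal : IsGreedyPackingColoring G k c → ∀ i → 1 ≤ i →
      MaximalIndependentIn (PowAdj G i) (Remaining (graph c) i) (Layer (graph c) i)
    greedy⇒graph-layer-maximal (packing@(inRange , _) , greedy) i 1≤i =
      layer⊆remaining , layer-independent , extend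
      where
      layer⊆remaining : ∀ x → Layer (graph c) i x → Remaining (graph c) i x
      layer⊆remaining x p j _ j<i q = <-irrefl (trans (∈-graph⁻ q) (sym (∈-graph⁻ p))) j<i

      layer-independent : IndependentIn (PowAdj G i) (Layer (graph c) i)
      layer-independent x y p q adj =
        packing⇒graph-GkIndependent packing _ _ p q (inj₂ (refl , adj))

      extend : ∀ x → Remaining (graph c) i x → ¬ Layer (graph c) i x →
        ∃ λ y → Layer (graph c) i y × PowAdj G i y x
      extend x remaining unlayered with <-cmp (c x) i
      ... | tri< cx<i _ _ = contradiction (∈-graph⁺ x) (remaining (c x) (proj₁ (inRange x)) cx<i)
      ... | tri≈ _ cx≡i _ =
        contradiction (subst (λ i → (x , i) ∈ graph c) cx≡i (∈-graph⁺ x)) unlayered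
      ... | tri> _ _ i<cx with u , cu≡i , i-close ← greedy x i 1≤i i<cx =
        u , subst (λ i → (u , i) ∈ graph c) cu≡i (∈-graph⁺ u) ,
        (λ u≡x → <-irrefl (trans (sym cu≡i) (cong c u≡x)) i<cx) , i-close

    greedy⇒graph-greedyLayering : IsGreedyPackingColoring G k c → IsGreedyLayering G k (graph c)
    greedy⇒graph-greedyLayering greedy@((inRange , _) , _) =
      (graph-unique , λ p → subst (λ i → 1 ≤ i × i ≤ k) (sym (∈-graph⁻ p)) (inRange _)) ,
      length-tabulate _ ,
      packing⇒graph-GkIndependent (proj₁ greedy) ,
      λ i 1≤i _ → greedy⇒graph-layer-maximal greedy i 1≤i

module ColouringOf {n} {G : Graph n} {k : ℕ} {A : List (Fin n × ℕ)}
  (unique : Unique A) (inRange : ∀ {v i} → (v , i) ∈ A → 1 ≤ i × i ≤ k)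
  (length≡n : length A ≡ n) (independent : GkIndependent G A)
  (maximal : ∀ i → 1 ≤ i → i < k → MaximalIndependentIn (PowAdj G i) (Remaining A i) (Layer A i))
  where

  private
    covers : ∀ v → ∃ λ i → (v , i) ∈ A
    covers = GkIndependent∧≤length⇒covers G unique independent (≤-reflexive (sym length≡n))

  colour : Fin n → ℕ
  colour v = proj₁ (covers v)

  colour-∈ : ∀ v → (v , colour v) ∈ A
  colour-∈ v = proj₂ (covers v)

  ∈⇒≡colour : ∀ {v i} → (v , i) ∈ A → i ≡ colour v
  ∈⇒≡colour p = GkIndependent⇒layer-unique G independent p (colour-∈ _)

  isPackingColoring : IsPackingColoring G k colour
  isPackingColoring =
    (λ v → inRange (colour-∈ v)) ,
    λ u v u≢v cu≡cv close →
      independent _ _ (colour-∈ u) (colour-∈ v) (inj₂ (cu≡cv , u≢v , close))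

  <colour⇒remaining : ∀ {v j} → j < colour v → Remaining A j v
  <colour⇒remaining j<cv j′ _ j′<j p = <-irrefl (∈⇒≡colour p) (<-trans j′<j j<cv)

  <colour⇒¬layer : ∀ {v j} → j < colour v → ¬ Layer A j v
  <colour⇒¬layer j<cv p = <-irrefl (∈⇒≡colour p) j<cv

  isGreedyPackingColoring : IsGreedyPackingColoring G k colour
  isGreedyPackingColoring = isPackingColoring , greedy
    where
    greedy : ∀ v j → 1 ≤ j → j < colour v → ∃ λ u → colour u ≡ j × Within G j u v
    greedy v j 1≤j j<cv
      with _ , _ , extend ← maximal j 1≤j (<-≤-trans j<cv (proj₂ (inRange (colour-∈ v))))
      with u , p , _ , j-close ← extend v (<colour⇒remaining j<cv) (<colour⇒¬layer j<cv)
      = u , sym (∈⇒≡colour p) , j-close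

lemma3 : ∀ {n} (G : Graph n) (k : ℕ) → 1 ≤ k → k ≤ n →
    (∃ λ (c : Fin n → ℕ) → IsGreedyPackingColoring G k c) ⇔
    (∃ λ (A : List (Fin n × ℕ)) →
       IsVertexSetOfGk k A ×
       length A ≡ n ×
       IndependentIn (GkAdj G) (λ x → x ∈ A) ×
       (∀ i → 1 ≤ i → i < k →
          MaximalIndependentIn (PowAdj G i) (Remaining A i) (Layer A i)))
lemma3 G k _ _ = mk⇔
  (λ (c , greedy) → graph c , greedy⇒graph-greedyLayering greedy)
  (λ (_ , (unique , inRange) , length≡n , independent , maximal) →
     let open ColouringOf unique inRange length≡n independent maximal
     in colour , isGreedyPackingColoring)
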